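{- For every trace $w\in(2^P)^\omega$ and every $\text{rLDL}$ formula $\varphi$, the value $V(w,\varphi)$ lies in $\mathbb B_4 = \{0000,0001,0011,0111,1111\}$.
   Context: Fix a finite non-empty set $P$ of atomic propositions. A trace is $w = w(0)w(1)\cdots\in (2^P)^\omega$; $w[j,\infty) = w(j)w(j+1)\cdots$. $\mathbb{B}_4$ is totally ordered by $0000 \prec 0001 \prec 0011 \prec 0111 \prec 1111$. Over subsets of $\{0,1\}$, $\min\emptyset = 1$ and $\max\emptyset = 0$. $\text{rLDL}$ formulas and guards: $\varphi ::= p \mid \neg\varphi \mid \varphi\wedge\varphi\mid\varphi\vee\varphi\mid\varphi\to\varphi\mid \langle\!\langle r\rangle\!\rangle\varphi \mid [\![ r]\!]\varphi$ and $r ::= \phi \mid \varphi? \mid r+r \mid r;r \mid r^*$, where $p\in P$ and $\phi$ ranges over propositional formulas over $P$. The semantics assigns to $w$ and $\varphi$ a four-bit string $V(w,\varphi) = V_1(w,\varphi)V_2(w,\varphi)V_3(w,\varphi)V_4(w,\varphi)\in\{0,1\}^4$, where $\min,\max$ on four-bit values below refer to the order $\preceq$ on $\mathbb B_4$: $V(w,p) = 1111$ if $p\in w(0)$, else $0000$; $V(w,\neg\varphi) = 0000$ if $V(w,\varphi)=1111$, else $1111$; $V(w,\varphi_0\wedge\varphi_1) = \min\{V(w,\varphi_0),V(w,\varphi_1)\}$; $V(w,\varphi_0\vee\varphi_1) = \max\{\cdot\}$; $V(w,\varphi_0\to\varphi_1) = 1111$ if $V(w,\varphi_0)\preceq V(w,\varphi_1)$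 and $V(w,\varphi_1)$ otherwise. Match sets $\mathcal R_i(w,r)\subseteq\mathbb N$ for $i\in\{1,2,3,4\}$: $\mathcal R_i(w,\phi)=\{1\}$ if $w(0)\models\phi$, else $\emptyset$; $\mathcal R_i(w,\psi?) = \{0\}$ if $V_i(w,\psi)=1$, else $\emptyset$; $\mathcal R_i(w,r_0+r_1) = \mathcal R_i(w,r_0)\cup\mathcal R_i(w,r_1)$; $\mathcal R_i(w,r_0;r_1) = \{j_0+j_1 \mid j_0\in\mathcal R_i(w,r_0), j_1\in\mathcal R_i(w[j_0,\infty),r_1)\}$; $\mathcal R_i(w,r^*) = \{0\}\cup\{j_1+\cdots+j_\ell \mid \ell\ge1,\ j_{\ell'}\in\mathcal R_i(w[j_1+\cdots+j_{\ell'-1},\infty),r)\text{ for all }\ell'\in\{1,\dots,\ell\}\}$. $V(w,\langle\!\langle r\rangle\!\rangle\varphi) = b_1b_2b_3b_4$ with $b_i = \max_{j\in\mathcal R_i(w,r)}V_i(w[j,\infty),\varphi)$. $V(w,[\![ r]\!]\varphi) = b_1b_2b_3b_4$ with $b_i = \max\{b'_1,\dots,b'_i\}$ where: $b'_1 = \min_{j\in\mathcal R_1(w,r)}V_1(w[j,\infty),\varphi)$; $b'_2 = \max_{j'\in\mathbb N}\min_{j\in\mathcal R_2(w,r), j\ge j'}V_2(w[j,\infty),\varphi)$ if $\mathcal R_2(w,r)$ is infinite, $\min_{j\in\mathcal R_2(w,r)}V_2(w[j,\infty),\varphi)$ if it is finite and non-empty, and $1$ if it is empty; $b'_3 = \min_{j'\in\mathbb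 N}\max_{j\in\mathcal R_3(w,r),j\ge j'}V_3(w[j,\infty),\varphi)$ if $\mathcal R_3(w,r)$ is infinite, $\max_{j\in\mathcal R_3(w,r)}V_3(w[j,\infty),\varphi)$ if it is finite and non-empty, and $1$ if empty; $b'_4 = \max_{j\in\mathcal R_4(w,r)}V_4(w[j,\infty),\varphi)$ if $\mathcal R_4(w,r)\neq\emptyset$, and $1$ otherwise. -}

module Defs where

open import Data.Nat using (ℕ; zero; suc; _+_; _<_) renaming (_≤_ to _≤ℕ_)
open import Data.Fin using (Fin; zero; suc) renaming (_≤_ to _≤F_)
open import Data.Bool using (Bool; true)
open import Data.List using (List; []; _∷_)
open import Data.Nat.ListAction using (sum)
open import Data.Product using (Σ; ∃; ∃-syntax; _×_; _,_)
open import Data.Sum using (_⊎_)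
open import Data.Unit using (⊤)
open import Data.Empty using (⊥)
open import Relation.Nullary using (¬_)
open import Relation.Binary.PropositionalEquality using (_≡_; _≢_)

-- Atomic propositions: P = Fin n (the statement uses n = suc m, so P is
-- finite and non-empty).  A letter w(i) ∈ 2^P is its characteristic function.
Letter : ℕ → Set
Letter n = Fin n → Bool

Trace : ℕ → Set
Trace n = ℕ → Letter n

suffix : ∀ {n} → Trace n → ℕ → Trace n
suffix w j k = w (j + k)

data PForm (n : ℕ) : Set where
  ptrue  : PForm n
  pfalse : PForm n
  patom  : Fin n → PForm n
  pnot   : PForm n → PForm n
  pand   : PForm n → PForm n → PForm n
  por    : PForm n → PForm n → PForm n
  pimp   : PForm n → PForm n → PForm n

_⊨_ : ∀ {n} → Letter n → PForm n → Set
σ ⊨ ptrue = ⊤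
σ ⊨ pfalse = ⊥
σ ⊨ patom p = σ p ≡ true
σ ⊨ pnot φ = ¬ (σ ⊨ φ)
σ ⊨ pand φ ψ = (σ ⊨ φ) × (σ ⊨ ψ)
σ ⊨ por φ ψ = (σ ⊨ φ) ⊎ (σ ⊨ ψ)
σ ⊨ pimp φ ψ = (σ ⊨ φ) → (σ ⊨ ψ)

mutual
  data Form (n : ℕ) : Set where
    atom : Fin n → Form n
    neg  : Form n → Form n
    and  : Form n → Form n → Form n
    or   : Form n → Form n → Form n
    imp  : Form n → Form n → Form n
    dia  : Reg n → Form n → Form n
    box  : Reg n → Form n → Form n

  data Reg (n : ℕ) : Set where
    guard : PForm n → Reg n
    test  : Form n → Reg n
    plus  : Reg n → Reg n → Reg n
    seq   : Reg n → Reg n → Reg n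
    star  : Reg n → Reg n

-- Truth values are classical propositions: a bit is the proposition
-- "this bit equals 1".  A four-bit value is indexed by Fin 4, where
-- index zero is the first bit b₁, …, index 3 is b₄.

FiniteSet : (ℕ → Set) → Set
FiniteSet R = ∃[ m ] (∀ j → R j → j < m)

InfiniteSet : (ℕ → Set) → Set
InfiniteSet R = ¬ FiniteSet R

EmptySet : (ℕ → Set) → Set
EmptySet R = ∀ j → ¬ R j

NonEmptySet : (ℕ → Set) → Set
NonEmptySet R = ∃[ j ] R j

mutual
  -- V w φ i : the (i+1)-th bit of V(w,φ) is 1.
  V : ∀ {n} → Trace n → Form n → Fin 4 → Set
  V w (atom p) i = w 0 p ≡ true
  -- 0000 if V(w,φ) = 1111, else 1111
  V w (neg φ) i = ¬ (∀ k → V w φ k)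
  -- min / max w.r.t. ⪯ on 𝔹₄ are bitwise and / or
  V w (and φ ψ) i = V w φ i × V w ψ i
  V w (or φ ψ) i = V w φ i ⊎ V w ψ i
  -- 1111 if V(w,φ) ⪯ V(w,ψ), and V(w,ψ) otherwise
  V w (imp φ ψ) i = (∀ k → V w φ k → V w ψ k) ⊎ V w ψ i
  V w (dia r φ) i = ∃[ j ] (Match w r i j × V (suffix w j) φ i)
  -- b_i = max {b'_1, …, b'_i}
  V w (box r φ) i = ∃[ k ] (k ≤F i × BoxBit w r φ k)

  BoxBit : ∀ {n} → Trace n → Reg n → Form n → Fin 4 → Set
  BoxBit w r φ zero =
    ∀ j → Match w r zero j → V (suffix w j) φ zero
  BoxBit w r φ (suc zero) =
      (InfiniteSet (Match w r k) ×
        ∃[ j' ] (∀ j → Match w r k j → j' ≤ℕ j → V (suffix w j) φ k))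
    ⊎ (FiniteSet (Match w r k) × NonEmptySet (Match w r k) ×
        (∀ j → Match w r k j → V (suffix w j) φ k))
    ⊎ EmptySet (Match w r k)
    where k = suc zero
  BoxBit w r φ (suc (suc zero)) =
      (InfiniteSet (Match w r k) ×
        (∀ j' → ∃[ j ] (Match w r k j × j' ≤ℕ j × V (suffix w j) φ k)))
    ⊎ (FiniteSet (Match w r k) × NonEmptySet (Match w r k) ×
        ∃[ j ] (Match w r k j × V (suffix w j) φ k))
    ⊎ EmptySet (Match w r k)
    where k = suc (suc zero)
  BoxBit w r φ (suc (suc (suc zero))) =
      (NonEmptySet (Match w r k) ×
        ∃[ j ] (Match w r k j × V (suffix w j) φ k))
    ⊎ EmptySet (Match w r k)
    where k = suc (suc (suc zero))

  -- Match w r i j : j ∈ 𝓡_{i+1}(w, r)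
  Match : ∀ {n} → Trace n → Reg n → Fin 4 → ℕ → Set
  Match w (guard φ) i j = j ≡ 1 × (w 0 ⊨ φ)
  Match w (test ψ) i j = j ≡ 0 × V w ψ i
  Match w (plus r₀ r₁) i j = Match w r₀ i j ⊎ Match w r₁ i j
  Match w (seq r₀ r₁) i j =
    ∃[ j₀ ] ∃[ j₁ ] (Match w r₀ i j₀ × Match (suffix w j₀) r₁ i j₁ × j ≡ j₀ + j₁)
  Match w (star r) i j =
    j ≡ 0 ⊎ ∃[ js ] (js ≢ [] × Chain w r i 0 js × sum js ≡ j)

  -- Chain w r i off (j_1 ∷ … ∷ j_ℓ): j_{ℓ'} ∈ 𝓡_i(w[off + j_1+…+j_{ℓ'-1},∞), r)
  Chain : ∀ {n} → Trace n → Reg n → Fin 4 → ℕ → List ℕ → Set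
  Chain w r i off [] = ⊤
  Chain w r i off (j ∷ js) = Match (suffix w off) r i j × Chain w r i (off + j) js

-- 𝔹₄ = {0000, 0001, 0011, 0111, 1111}: exactly the bit strings
-- b₁b₂b₃b₄ with b₁ ≤ b₂ ≤ b₃ ≤ b₄.
InB4 : (Fin 4 → Set) → Set
InB4 b = (b zero → b (suc zero))
       × (b (suc zero) → b (suc (suc zero)))
       × (b (suc (suc zero)) → b (suc (suc (suc zero))))

module Submission where

open import Data.Nat using (ℕ; suc; _+_; z≤n; s≤s)
open import Data.Fin using (Fin; zero; suc) renaming (_≤_ to _≤F_)
open import Data.Fin.Properties using (≤-trans)
open import Data.List using (List; []; _∷_)
open import Data.Product using (_,_)
open import Data.Sum using (inj₁; inj₂)
open import Defs

-- A value lies in 𝔹₄ iff its bits increase with the index, and raising the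
-- index only weakens every clause of the semantics: match sets grow, the
-- bits of ¬ and of the first disjunct of → do not depend on the index, and
-- the bit b_i of [[ r ]] φ is a maximum over the prefix b'_1, …, b'_i.

mutual
  V-mono : ∀ {n i i'} → i ≤F i' → (w : Trace n) (φ : Form n) → V w φ i → V w φ i'
  V-mono i≤i' w (atom p) v = v
  V-mono i≤i' w (neg φ) v = v
  V-mono i≤i' w (and φ ψ) (vφ , vψ) = V-mono i≤i' w φ vφ , V-mono i≤i' w ψ vψ
  V-mono i≤i' w (or φ ψ) (inj₁ vφ) = inj₁ (V-mono i≤i' w φ vφ)
  V-mono i≤i' w (or φ ψ) (inj₂ vψ) = inj₂ (V-mono i≤i' w ψ vψ)
  V-mono i≤i' w (imp φ ψ) (inj₁ φ⪯ψ) = inj₁ φ⪯ψ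
  V-mono i≤i' w (imp φ ψ) (inj₂ vψ) = inj₂ (V-mono i≤i' w ψ vψ)
  V-mono i≤i' w (dia r φ) (j , m , v) =
    j , Match-mono i≤i' w r j m , V-mono i≤i' (suffix w j) φ v
  V-mono i≤i' w (box r φ) (k , k≤i , b) = k , ≤-trans k≤i i≤i' , b

  Match-mono : ∀ {n i i'} → i ≤F i' → (w : Trace n) (r : Reg n) (j : ℕ) →
               Match w r i j → Match w r i' j
  Match-mono i≤i' w (guard φ) j m = m
  Match-mono i≤i' w (test ψ) j (j≡0 , v) = j≡0 , V-mono i≤i' w ψ v
  Match-mono i≤i' w (plus r₀ r₁) j (inj₁ m) = inj₁ (Match-mono i≤i' w r₀ j m)
  Match-mono i≤i' w (plus r₀ r₁) j (inj₂ m) = inj₂ (Match-mono i≤i' w r₁ j m)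
  Match-mono i≤i' w (seq r₀ r₁) j (j₀ , j₁ , m₀ , m₁ , j≡) =
    j₀ , j₁ , Match-mono i≤i' w r₀ j₀ m₀ , Match-mono i≤i' (suffix w j₀) r₁ j₁ m₁ , j≡
  Match-mono i≤i' w (star r) j (inj₁ j≡0) = inj₁ j≡0
  Match-mono i≤i' w (star r) j (inj₂ (js , js≢[] , c , sum≡j)) =
    inj₂ (js , js≢[] , Chain-mono i≤i' w r 0 js c , sum≡j)

  Chain-mono : ∀ {n i i'} → i ≤F i' → (w : Trace n) (r : Reg n) (off : ℕ) (js : List ℕ) →
               Chain w r i off js → Chain w r i' off js
  Chain-mono i≤i' w r off [] c = c
  Chain-mono i≤i' w r off (j ∷ js) (m , c) =
    Match-mono i≤i' (suffix w off) r j m , Chain-mono i≤i' w r (off + j) js c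

lemma2 : ∀ {m : ℕ} (w : Trace (suc m)) (φ : Form (suc m)) → InB4 (V w φ)
lemma2 w φ = V-mono z≤n w φ , V-mono (s≤s z≤n) w φ , V-mono (s≤s (s≤s z≤n)) w φ
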